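{- Let $\Phi$ be a root system of type $D_4$ with simple roots $\Pi$ and positive roots $\Phi^+$. Then for every ideal $\mathcal{I}$ of $\Phi^+$, $\mathcal{I}(t)=\prod_{i=1}^{s}(1+t+\cdots+t^{m_i^\mathcal{I}})$.
   Context: Heights $\mathrm{ht}(\sum_{\alpha\in\Pi}c_\alpha\alpha)=\sum c_\alpha$. An ideal of $\Phi^+$ is $\mathcal{I}\subseteq\Phi^+$ with $\alpha\in\mathcal{I},\beta\in\Phi^+,\alpha+\beta\in\Phi^+\Rightarrow\alpha+\beta\in\mathcal{I}$; $\mathcal{I}^c=\Phi^+\setminus\mathcal{I}$. Ideal exponents: $\lambda_i=|\{\alpha\in\mathcal{I}^c:\mathrm{ht}\alpha=i\}|$, $s=\lambda_1$, $m_i^\mathcal{I}=|\{j:\lambda_j\ge s-i+1\}|$ ($1\le i\le s$). For $R\subseteq\Phi^+$, $S\subseteq R$ is $R$-closed if $\alpha,\beta\in S$, $\alpha+\beta\in R$ imply $\alpha+\beta\in S$; $S\subseteq\mathcal{I}^c$ is of Weyl type for $\mathcal{I}$ if both $S$ and $\mathcal{I}^c\setminus S$ are $\mathcal{I}^c$-closed; $\mathcal{I}(t)=\sum_S t^{|S|}$ over all $S$ of Weyl type for $\mathcal{I}$. -}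

module Defs where

open import Data.Nat using (ℕ; zero; suc; _+_; _*_; _∸_; _≤_; _≤?_)
import Data.Nat.Properties as ℕP
open import Data.Bool using (Bool; true; false; if_then_else_)
open import Data.Fin using (Fin)
open import Data.Fin.Subset using (Subset; _∈_; _∉_; ∁; ∣_∣; _⊆_)
open import Data.Fin.Subset.Properties using (_∈?_)
open import Data.Fin.Properties using (all?)
open import Data.Vec using (Vec; []; _∷_; lookup; zipWith)
import Data.Vec as Vec
open import Data.Vec.Properties using (≡-dec)
open import Data.List using (List; []; _∷_; length; filter; map; foldr; upTo; applyUpTo; allFin)
open import Data.Nat.ListAction using (sum)
open import Data.Product using (_×_; _,_)
open import Relation.Nullary using (Dec; ¬_)
open import Relation.Nullary.Decidable using (_×-dec_; _→-dec_; ¬?; does)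
open import Relation.Binary.PropositionalEquality using (_≡_)

-- The positive roots of D₄, written in the basis of simple roots
-- Π = {α₁, α₂, α₃, α₄}  (Bourbaki labelling: α₂ is the central node,
-- joined to α₁, α₃, α₄).  There are 12 positive roots.

Root : Set
Root = Vec ℕ 4

N : ℕ
N = 12

positiveRoots : Vec Root N
positiveRoots =
    (1 ∷ 0 ∷ 0 ∷ 0 ∷ [])
  ∷ (0 ∷ 1 ∷ 0 ∷ 0 ∷ [])
  ∷ (0 ∷ 0 ∷ 1 ∷ 0 ∷ [])
  ∷ (0 ∷ 0 ∷ 0 ∷ 1 ∷ [])
  ∷ (1 ∷ 1 ∷ 0 ∷ 0 ∷ [])
  ∷ (0 ∷ 1 ∷ 1 ∷ 0 ∷ [])
  ∷ (0 ∷ 1 ∷ 0 ∷ 1 ∷ [])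
  ∷ (1 ∷ 1 ∷ 1 ∷ 0 ∷ [])
  ∷ (1 ∷ 1 ∷ 0 ∷ 1 ∷ [])
  ∷ (0 ∷ 1 ∷ 1 ∷ 1 ∷ [])
  ∷ (1 ∷ 1 ∷ 1 ∷ 1 ∷ [])
  ∷ (1 ∷ 2 ∷ 1 ∷ 1 ∷ [])
  ∷ []

root : Fin N → Root
root i = lookup positiveRoots i

_⊕_ : Root → Root → Root
_⊕_ = zipWith _+_

ht : Root → ℕ
ht = Vec.foldr _ _+_ 0

-- Subsets of Φ⁺ are Subset N.  α + β ∈ Φ⁺ with α + β = γ is expressed by
-- root i ⊕ root j ≡ root k (positive roots are pairwise distinct).

IsIdeal : Subset N → Set
IsIdeal I = ∀ i j k → root i ⊕ root j ≡ root k → i ∈ I → k ∈ I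

-- S is R-closed (S ⊆ R is imposed separately)
Closed : Subset N → Subset N → Set
Closed R S = ∀ i j k → root i ⊕ root j ≡ root k → i ∈ S → j ∈ S → k ∈ R → k ∈ S

_∖_ : Subset N → Subset N → Subset N
A ∖ B = zipWith (λ a b → if b then false else a) A B

WeylType : Subset N → Subset N → Set
WeylType I S = (S ⊆ ∁ I) × Closed (∁ I) S × Closed (∁ I) (∁ I ∖ S)

closed? : ∀ R S → Dec (Closed R S)
closed? R S = all? λ i → all? λ j → all? λ k →
  ≡-dec ℕP._≟_ (root i ⊕ root j) (root k) →-dec
  (i ∈? S) →-dec (j ∈? S) →-dec (k ∈? R) →-dec (k ∈? S)

⊆? : ∀ (A B : Subset N) → Dec (A ⊆ B)
⊆? A B with all? (λ i → (i ∈? A) →-dec (i ∈? B))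
... | Relation.Nullary.yes p = Relation.Nullary.yes (λ {x} x∈A → p x x∈A)
... | Relation.Nullary.no ¬p = Relation.Nullary.no (λ s → ¬p (λ i i∈A → s i∈A))

weylType? : ∀ I S → Dec (WeylType I S)
weylType? I S = ⊆? S (∁ I) ×-dec closed? (∁ I) S ×-dec closed? (∁ I) (∁ I ∖ S)

-- Polynomials in t with coefficients in ℕ, represented by their
-- coefficient sequence (coefficient of t^n).

Poly : Set
Poly = ℕ → ℕ

allSubsets : ∀ n → List (Subset n)
allSubsets zero = [] ∷ []
allSubsets (suc n) = map (true ∷_) (allSubsets n) Data.List.++ map (false ∷_) (allSubsets n)

weylPoly : Subset N → Poly
weylPoly I n = length (filter (λ S → weylType? I S ×-dec (∣ S ∣ ℕP.≟ n)) (allSubsets N))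

geomPoly : ℕ → Poly
geomPoly m n = if does (n ≤? m) then 1 else 0

onePoly : Poly
onePoly zero = 1
onePoly (suc _) = 0

_⊛_ : Poly → Poly → Poly
(f ⊛ g) n = sum (map (λ k → f k * g (n ∸ k)) (upTo (suc n)))

lam : Subset N → ℕ → ℕ
lam I i = length (filter (λ k → (k ∈? ∁ I) ×-dec (ht (root k) ℕP.≟ i)) (allFin N))

sExp : Subset N → ℕ
sExp I = lam I 1

-- every positive root of D₄ has height ≤ 5 ≤ N, so λ_j = 0 for j > N;
-- since s - i + 1 ≥ 1 for i ≤ s, it suffices to range j over 1..N.
heightRange : List ℕ
heightRange = applyUpTo suc N

mExp : Subset N → ℕ → ℕ
mExp I i = length (filter (λ j → (sExp I ∸ i + 1) ≤? lam I j) heightRange)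

exponentPoly : Subset N → Poly
exponentPoly I = foldr (λ i p → geomPoly (mExp I i) ⊛ p) onePoly (applyUpTo suc (sExp I))

module Submission where

-- Corollary 6.3 for D₄ is a statement about finitely many objects: the
-- ideals I among the 2¹² subsets of Φ⁺ and, for each, the 2¹² candidate
-- subsets S ⊆ Iᶜ.  We prove it by a verified computation organised so that
-- evaluation stays cheap.
--   1. The additive structure of Φ⁺ is the explicit table of the 32 triples
--      (α, β, α + β); the table is shown sound and complete by evaluation,
--      so "closed", "ideal" and "Weyl type" become Boolean checks over it.
--   2. The coefficients of 𝓘(t) are read off one histogram of the sizes of
--      the Weyl-type subsets.
--   3. A product of factors 1 + t + ⋯ + t^m has degree Σ m, and 𝓘(t) has
--      degree ≤ |Φ⁺| = 12; so once Σ mᵢ ≤ 12, both sides agree in every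
--      degree as soon as they agree in degrees 0, …, 12.
--   4. For every ideal I, the histogram and the first 13 coefficients of
--      ∏ (1 + ⋯ + t^{mᵢ}) agree and Σ mᵢ ≤ 12: checked by evaluation.
-- The theorem follows by comparing coefficients below and above degree 12.

open import Defs
open import Data.Nat using (ℕ; zero; suc; _+_; _*_; _∸_; _≤_; _<_; _≤ᵇ_; _≡ᵇ_; _≤?_; _<?_)
open import Data.Nat.Properties
  using (≤ᵇ⇒≤; ≡ᵇ⇒≡; *-zeroʳ; +-comm; +-monoʳ-≤; ≮⇒≥; <⇒≱; ≤-<-trans; m+n≤o⇒m≤o∸n; _≟_; module ≤-Reasoning)
open import Data.Nat.ListAction using (sum)
open import Data.Bool using (Bool; true; false; not; _∧_; _∨_; if_then_else_; T)
open import Data.Bool.Properties using (T-≡; T-∧)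
open import Data.Unit using (tt)
open import Data.Fin using (Fin; #_)
import Data.Fin.Properties as Fin
open import Data.Fin.Subset using (Subset; ∁; ∣_∣; _∈_; _⊆_)
open import Data.Fin.Subset.Properties using (∣p∣≤n)
open import Data.Vec as Vec using (lookup; _∷_)
open import Data.Vec.Properties using ([]=⇒lookup; lookup⇒[]=; ≡-dec)
open import Data.Bool.ListAction using (all)
open import Data.List using (List; []; _∷_; allFin; upTo; applyUpTo; map; filter; length; foldr)
open import Data.List.Relation.Unary.All as All using (All)
open import Data.List.Relation.Unary.Any using (here)
open import Data.List.Relation.Unary.All.Properties using (all⁺; all⁻)
open import Data.List.Membership.Propositional using () renaming (_∈_ to _∈ₗ_)
open import Data.List.Membership.Propositional.Properties using (∈-map⁺; ∈-++⁺ˡ; ∈-++⁺ʳ; ∈-upTo⁺; ∈-allFin)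
open import Data.List.Properties using (filter-none)
open import Data.Product using (_×_; _,_; proj₁; proj₂)
import Data.Product.Properties as Product
open import Data.Product.Function.NonDependent.Propositional using (_×-⇔_)
open import Function using (_∘_; _⇔_; mk⇔; Equivalence)
import Function.Properties.Equivalence as ⇔
open import Function.Related.TypeIsomorphisms using (→-cong-⇔)
open import Relation.Nullary using (Dec; yes; no)
open import Relation.Nullary.Decidable using (does; T?; toWitness; does-⇔; dec-false; _→-dec_; _×-dec_)
open import Relation.Binary.PropositionalEquality using (_≡_; refl; sym; trans; cong; subst; module ≡-Reasoning)

open Equivalence using (to; from)

infixr 4 _⇒ᵇ_
_⇒ᵇ_ : Bool → Bool → Bool
a ⇒ᵇ b = not a ∨ b

T-⇒ᵇ : ∀ {a b} → T (a ⇒ᵇ b) ⇔ (T a → T b)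
T-⇒ᵇ {false} = mk⇔ (λ _ ()) (λ _ → tt)
T-⇒ᵇ {true}  = mk⇔ (λ t _ → t) (λ f → f tt)

∈⇔T : ∀ {n} {x : Fin n} {S : Subset n} → x ∈ S ⇔ T (lookup S x)
∈⇔T {x = x} {S} = mk⇔ (from T-≡ ∘ []=⇒lookup) (lookup⇒[]= x S ∘ to T-≡)

All⇔all : ∀ {A : Set} {P : A → Set} (p : A → Bool) →
          (∀ x → P x ⇔ T (p x)) → ∀ xs → All P xs ⇔ T (all p xs)
All⇔all p P⇔p xs =
  mk⇔ (all⁻ p ∘ All.map (to (P⇔p _))) (All.map (from (P⇔p _)) ∘ all⁺ p xs)

∀Fin⇔All : ∀ {n} {P : Fin n → Set} → (∀ i → P i) ⇔ All P (allFin n)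
∀Fin⇔All = mk⇔ (λ h → All.tabulate (λ {i} _ → h i)) (λ a i → All.lookup a (∈-allFin i))

Triple : Set
Triple = Fin N × Fin N × Fin N

IsSum : Triple → Set
IsSum (i , j , k) = root i ⊕ root j ≡ root k

isSum? : ∀ t → Dec (IsSum t)
isSum? (i , j , k) = ≡-dec _≟_ (root i ⊕ root j) (root k)

sumTable : List Triple
sumTable =
    (# 0 , # 1 , # 4)  ∷ (# 0 , # 5 , # 7)  ∷ (# 0 , # 6 , # 8)  ∷ (# 0 , # 9 , # 10)
  ∷ (# 1 , # 0 , # 4)  ∷ (# 1 , # 2 , # 5)  ∷ (# 1 , # 3 , # 6)  ∷ (# 1 , # 10 , # 11)
  ∷ (# 2 , # 1 , # 5)  ∷ (# 2 , # 4 , # 7)  ∷ (# 2 , # 6 , # 9)  ∷ (# 2 , # 8 , # 10)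
  ∷ (# 3 , # 1 , # 6)  ∷ (# 3 , # 4 , # 8)  ∷ (# 3 , # 5 , # 9)  ∷ (# 3 , # 7 , # 10)
  ∷ (# 4 , # 2 , # 7)  ∷ (# 4 , # 3 , # 8)  ∷ (# 4 , # 9 , # 11) ∷ (# 5 , # 0 , # 7)
  ∷ (# 5 , # 3 , # 9)  ∷ (# 5 , # 8 , # 11) ∷ (# 6 , # 0 , # 8)  ∷ (# 6 , # 2 , # 9)
  ∷ (# 6 , # 7 , # 11) ∷ (# 7 , # 3 , # 10) ∷ (# 7 , # 6 , # 11) ∷ (# 8 , # 2 , # 10)
  ∷ (# 8 , # 5 , # 11) ∷ (# 9 , # 0 , # 10) ∷ (# 9 , # 4 , # 11) ∷ (# 10 , # 1 , # 11)
  ∷ []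

_≟ₜ_ : (s t : Triple) → Dec (s ≡ t)
_≟ₜ_ = Product.≡-dec Fin._≟_ (Product.≡-dec Fin._≟_ Fin._≟_)

open import Data.List.Membership.DecPropositional _≟ₜ_ using () renaming (_∈?_ to _∈ₜ?_)

sumTable-sound : All IsSum sumTable
sumTable-sound = toWitness {a? = All.all? isSum? sumTable} tt

sumTable-complete : (i j k : Fin N) → IsSum (i , j , k) → (i , j , k) ∈ₗ sumTable
sumTable-complete = toWitness {a? = decision} tt
  where
  decision : Dec ((i j k : Fin N) → IsSum (i , j , k) → (i , j , k) ∈ₗ sumTable)
  decision = Fin.all? λ i → Fin.all? λ j → Fin.all? λ k →
             isSum? (i , j , k) →-dec ((i , j , k) ∈ₜ? sumTable)

∀Sum⇔All : ∀ {P : Triple → Set} →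
           (∀ i j k → IsSum (i , j , k) → P (i , j , k)) ⇔ All P sumTable
∀Sum⇔All = mk⇔ (λ h → All.map (λ { {i , j , k} → h i j k }) sumTable-sound)
                (λ a i j k s → All.lookup a (sumTable-complete i j k s))

⇒ᵇ-reflects : ∀ {P Q : Set} {a b} → P ⇔ T a → Q ⇔ T b → (P → Q) ⇔ T (a ⇒ᵇ b)
⇒ᵇ-reflects P⇔a Q⇔b = ⇔.trans (→-cong-⇔ P⇔a Q⇔b) (⇔.sym T-⇒ᵇ)

∧-reflects : ∀ {P Q : Set} {a b} → P ⇔ T a → Q ⇔ T b → (P × Q) ⇔ T (a ∧ b)
∧-reflects P⇔a Q⇔b = ⇔.trans (P⇔a ×-⇔ Q⇔b) (⇔.sym T-∧)

IdealAt : Subset N → Triple → Set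
IdealAt I (i , _ , k) = i ∈ I → k ∈ I

idealAtᵇ : Subset N → Triple → Bool
idealAtᵇ I (i , _ , k) = lookup I i ⇒ᵇ lookup I k

idealᵇ : Subset N → Bool
idealᵇ I = all (idealAtᵇ I) sumTable

ideal⇔ : ∀ I → IsIdeal I ⇔ T (idealᵇ I)
ideal⇔ I = ⇔.trans (∀Sum⇔All {IdealAt I})
  (All⇔all (idealAtᵇ I) (λ { (i , j , k) → ⇒ᵇ-reflects ∈⇔T ∈⇔T }) sumTable)

ClosedAt : Subset N → Subset N → Triple → Set
ClosedAt R S (i , j , k) = i ∈ S → j ∈ S → k ∈ R → k ∈ S

closedAtᵇ : Subset N → Subset N → Triple → Bool
closedAtᵇ R S (i , j , k) = lookup S i ⇒ᵇ lookup S j ⇒ᵇ lookup R k ⇒ᵇ lookup S k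

closedᵇ : Subset N → Subset N → Bool
closedᵇ R S = all (closedAtᵇ R S) sumTable

closed⇔ : ∀ R S → Closed R S ⇔ T (closedᵇ R S)
closed⇔ R S = ⇔.trans (∀Sum⇔All {ClosedAt R S})
  (All⇔all (closedAtᵇ R S)
    (λ { (i , j , k) → ⇒ᵇ-reflects ∈⇔T (⇒ᵇ-reflects ∈⇔T (⇒ᵇ-reflects ∈⇔T ∈⇔T)) })
    sumTable)

subsetᵇ : Subset N → Subset N → Bool
subsetᵇ A B = all (λ i → lookup A i ⇒ᵇ lookup B i) (allFin N)

subset⇔ : ∀ A B → A ⊆ B ⇔ T (subsetᵇ A B)
subset⇔ A B = ⇔.trans (mk⇔ (λ A⊆B i → A⊆B {i}) (λ A⊆B {i} → A⊆B i))
  (⇔.trans ∀Fin⇔All (All⇔all _ (λ _ → ⇒ᵇ-reflects ∈⇔T ∈⇔T) (allFin N)))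

weylTypeᵇ : Subset N → Subset N → Bool
weylTypeᵇ I S = subsetᵇ S (∁ I) ∧ closedᵇ (∁ I) S ∧ closedᵇ (∁ I) (∁ I ∖ S)

does-weylType? : ∀ I S → does (weylType? I S) ≡ weylTypeᵇ I S
does-weylType? I S = does-⇔ weylType⇔ (weylType? I S) (T? (weylTypeᵇ I S))
  where
  weylType⇔ : WeylType I S ⇔ T (weylTypeᵇ I S)
  weylType⇔ = ∧-reflects (subset⇔ S (∁ I)) (∧-reflects (closed⇔ (∁ I) S) (closed⇔ (∁ I) (∁ I ∖ S)))

coeff : List ℕ → ℕ → ℕ
coeff []      _       = 0
coeff (c ∷ _) zero    = c
coeff (_ ∷ h) (suc n) = coeff h n

bump : ℕ → List ℕ → List ℕ
bump zero    []      = 1 ∷ []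
bump zero    (c ∷ h) = suc c ∷ h
bump (suc k) []      = 0 ∷ bump k []
bump (suc k) (c ∷ h) = c ∷ bump k h

coeff-bump : ∀ k h n → coeff (bump k h) n ≡ (if k ≡ᵇ n then suc (coeff h n) else coeff h n)
coeff-bump zero    []      zero    = refl
coeff-bump zero    []      (suc n) = refl
coeff-bump zero    (c ∷ h) zero    = refl
coeff-bump zero    (c ∷ h) (suc n) = refl
coeff-bump (suc k) []      zero    = refl
coeff-bump (suc k) []      (suc n) = coeff-bump k [] n
coeff-bump (suc k) (c ∷ h) zero    = refl
coeff-bump (suc k) (c ∷ h) (suc n) = coeff-bump k h n

histogram : ∀ {A : Set} → (A → Bool) → (A → ℕ) → List A → List ℕ
histogram p size []       = []
histogram p size (x ∷ xs) = if p x then bump (size x) (histogram p size xs) else histogram p size xs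

count≡coeff : ∀ {A : Set} {P : A → Set} (P? : ∀ x → Dec (P x)) (p : A → Bool) →
              (∀ x → does (P? x) ≡ p x) → ∀ size xs n →
              length (filter (λ x → P? x ×-dec (size x ≟ n)) xs) ≡ coeff (histogram p size xs) n
count≡coeff P? p P?≡p size []       n = refl
count≡coeff P? p P?≡p size (x ∷ xs) n rewrite P?≡p x with p x
... | false = count≡coeff P? p P?≡p size xs n
... | true rewrite coeff-bump (size x) (histogram p size xs) n with size x ≡ᵇ n
...   | true  = cong suc (count≡coeff P? p P?≡p size xs n)
...   | false = count≡coeff P? p P?≡p size xs n

_HasDegree≤_ : Poly → ℕ → Set
p HasDegree≤ d = ∀ n → d < n → p n ≡ 0

onePoly-degree : onePoly HasDegree≤ 0
onePoly-degree (suc n) _ = refl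

geomPoly-degree : ∀ m → geomPoly m HasDegree≤ m
geomPoly-degree m n m<n rewrite dec-false (n ≤? m) (<⇒≱ m<n) = refl

sum-map-zero : ∀ (f : ℕ → ℕ) xs → (∀ x → f x ≡ 0) → sum (map f xs) ≡ 0
sum-map-zero f []       f≡0 = refl
sum-map-zero f (x ∷ xs) f≡0 rewrite f≡0 x = sum-map-zero f xs f≡0

-- Degrees add under the Cauchy product: every term f k · g (n ∸ k) of a
-- coefficient of degree n > d + e has k > d or n ∸ k > e.
⊛-degree : ∀ {f g d e} → f HasDegree≤ d → g HasDegree≤ e → (f ⊛ g) HasDegree≤ (d + e)
⊛-degree {f} {g} {d} {e} f≤d g≤e n d+e<n = sum-map-zero _ (upTo (suc n)) term
  where
  term : ∀ k → f k * g (n ∸ k) ≡ 0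
  term k with d <? k
  ... | yes d<k = cong (_* g (n ∸ k)) (f≤d k d<k)
  ... | no  d≮k = trans (cong (f k *_) (g≤e (n ∸ k) e<n∸k)) (*-zeroʳ (f k))
    where
    open ≤-Reasoning
    e<n∸k : e < n ∸ k
    e<n∸k = m+n≤o⇒m≤o∸n (suc e) (begin
      suc e + k  ≤⟨ +-monoʳ-≤ (suc e) (≮⇒≥ d≮k) ⟩
      suc e + d  ≡⟨ cong suc (+-comm e d) ⟩
      suc (d + e) ≤⟨ d+e<n ⟩
      n          ∎)

geomProduct-degree : ∀ (g : ℕ → ℕ) L →
                     foldr (λ i p → geomPoly (g i) ⊛ p) onePoly L HasDegree≤ sum (map g L)
geomProduct-degree g []      = onePoly-degree
geomProduct-degree g (i ∷ L) = ⊛-degree (geomPoly-degree (g i)) (geomProduct-degree g L)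

exponentDegree : Subset N → ℕ
exponentDegree I = sum (map (mExp I) (applyUpTo suc (sExp I)))

exponentPoly-degree : ∀ I → exponentPoly I HasDegree≤ exponentDegree I
exponentPoly-degree I = geomProduct-degree (mExp I) (applyUpTo suc (sExp I))

-- A subset of Φ⁺ has at most 12 elements, so 𝓘(t) has degree ≤ 12.
weylPoly-degree : ∀ I → weylPoly I HasDegree≤ N
weylPoly-degree I n N<n = cong length (filter-none (λ S → weylType? I S ×-dec (∣ S ∣ ≟ n))
  (All.universal (λ S (_ , ∣S∣≡n) → <⇒≱ N<n (subst (_≤ N) ∣S∣≡n (∣p∣≤n S))) (allSubsets N)))

allSubsets-complete : ∀ n (S : Subset n) → S ∈ₗ allSubsets n
allSubsets-complete zero    Vec.[]      = here refl
allSubsets-complete (suc n) (true  ∷ S) = ∈-++⁺ˡ (∈-map⁺ (true ∷_) (allSubsets-complete n S))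
allSubsets-complete (suc n) (false ∷ S) =
  ∈-++⁺ʳ (map (true ∷_) (allSubsets n)) (∈-map⁺ (false ∷_) (allSubsets-complete n S))

-- The 4096 subsets of Φ⁺, kept opaque so that reasoning about a variable
-- ideal never unfolds this list; only the verification below does.
opaque
  subsetsOfΦ⁺ : List (Subset N)
  subsetsOfΦ⁺ = allSubsets N

weylHistogram : Subset N → List ℕ
weylHistogram I = histogram (weylTypeᵇ I) ∣_∣ subsetsOfΦ⁺

opaque
  unfolding subsetsOfΦ⁺

  weylPoly≡coeff : ∀ I n → weylPoly I n ≡ coeff (weylHistogram I) n
  weylPoly≡coeff I = count≡coeff (weylType? I) (weylTypeᵇ I) (does-weylType? I) ∣_∣ (allSubsets N)

-- What is checked for each ideal: the coefficients of degree 0, …, 12 agree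
-- and Σ mᵢ ≤ 12.  The histogram h is an argument so that evaluation builds
-- it once per ideal rather than once per coefficient.
agreesAtᵇ : List ℕ → Subset N → ℕ → Bool
agreesAtᵇ h I n = coeff h n ≡ᵇ exponentPoly I n

lowAgreementᵇ : List ℕ → Subset N → Bool
lowAgreementᵇ h I = all (agreesAtᵇ h I) (upTo (suc N))

certificateᵇ : Subset N → Bool
certificateᵇ I = lowAgreementᵇ (weylHistogram I) I ∧ (exponentDegree I ≤ᵇ N)

certifiedᵇ : Subset N → Bool
certifiedᵇ I = idealᵇ I ⇒ᵇ certificateᵇ I

opaque
  unfolding subsetsOfΦ⁺

  -- Evaluation, split by the first four coordinates of I to keep each
  -- normalisation problem small.  Stated as an equation closed by refl,
  -- which the conversion checker decides much faster than it normalises T _.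
  certifiedBlock : ∀ a b c d → all (λ r → certifiedᵇ (a ∷ b ∷ c ∷ d ∷ r)) (allSubsets 8) ≡ true
  certifiedBlock true true true true = refl
  certifiedBlock true true true false = refl
  certifiedBlock true true false true = refl
  certifiedBlock true true false false = refl
  certifiedBlock true false true true = refl
  certifiedBlock true false true false = refl
  certifiedBlock true false false true = refl
  certifiedBlock true false false false = refl
  certifiedBlock false true true true = refl
  certifiedBlock false true true false = refl
  certifiedBlock false true false true = refl
  certifiedBlock false true false false = refl
  certifiedBlock false false true true = refl
  certifiedBlock false false true false = refl
  certifiedBlock false false false true = refl
  certifiedBlock false false false false = refl

certified : ∀ I → T (certifiedᵇ I)
certified (a ∷ b ∷ c ∷ d ∷ r) = All.lookup
  (all⁺ (λ r → certifiedᵇ (a ∷ b ∷ c ∷ d ∷ r)) (allSubsets 8) (from T-≡ (certifiedBlock a b c d)))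
  (allSubsets-complete 8 r)

ideal-certificate : ∀ I → IsIdeal I →
  (∀ n → n < suc N → coeff (weylHistogram I) n ≡ exponentPoly I n) × exponentDegree I ≤ N
ideal-certificate I isIdeal = agree , ≤ᵇ⇒≤ (exponentDegree I) N (proj₂ checked)
  where
  checked : T (lowAgreementᵇ (weylHistogram I) I) × T (exponentDegree I ≤ᵇ N)
  checked = to T-∧ (to T-⇒ᵇ (certified I) (to (ideal⇔ I) isIdeal))

  agree : ∀ n → n < suc N → coeff (weylHistogram I) n ≡ exponentPoly I n
  agree n n≤N = ≡ᵇ⇒≡ (coeff (weylHistogram I) n) (exponentPoly I n)
    (All.lookup (all⁺ (agreesAtᵇ (weylHistogram I) I) (upTo (suc N)) (proj₁ checked)) (∈-upTo⁺ n≤N))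

-- Below degree 13 the coefficients agree by the certificate; above, both
-- sides vanish by the degree bounds.
corollary6p3 : (I : Subset N) → IsIdeal I → (n : ℕ) → weylPoly I n ≡ exponentPoly I n
corollary6p3 I isIdeal n = byDegree (n <? suc N)
  where
  open ≡-Reasoning

  byDegree : Dec (n < suc N) → weylPoly I n ≡ exponentPoly I n
  byDegree (yes n≤N) = trans (weylPoly≡coeff I n) (proj₁ (ideal-certificate I isIdeal) n n≤N)
  byDegree (no  n≰N) = begin
    weylPoly I n      ≡⟨ weylPoly-degree I n N<n ⟩
    0                 ≡⟨ sym (exponentPoly-degree I n (≤-<-trans Σm≤N N<n)) ⟩
    exponentPoly I n  ∎
    where
    N<n : N < n
    N<n = ≮⇒≥ n≰N
    Σm≤N : exponentDegree I ≤ N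
    Σm≤N = proj₂ (ideal-certificate I isIdeal)
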